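{- For any graphs $G$ and $J$ (not necessarily connected), $c_H(G \vee J) \leq \Upsilon(G) + \Upsilon(J)$.
   Context: The join $G \vee J$ has vertex set $V(G) \cup V(J)$ (disjoint union) and edge set $E(G) \cup E(J) \cup \{uv : u \in V(G), v \in V(J)\}$; it is connected. Hyperopic Cops and Robber on a graph $H$ (each vertex considered to carry a loop, so a player may stay put): the cops first occupy a multiset of vertices, then the robber chooses a vertex. In each round, each cop moves to an adjacent vertex or stays, then the robber moves to an adjacent vertex or stays. The robber always sees all cops. The cops see the robber's position except when the robber's vertex is adjacent to every vertex occupied by a cop, in which case the robber is invisible. The robber is captured when a cop occupies the robber's vertex. $c_H(H)$ is the minimum number of cops that can guarantee capture in finitely many moves. $N(v)$ denotes the open neighbourhood of $v$. A non-empty set $S \subseteq V(G)$ is a small common neighbourhood set of $G$ if $\left|\bigcap_{v\in S} N_G(v)\right| \le |S|$; $\Upsilon(G)$ is the minimum cardinality of such a set. -}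

module Defs where

open import Data.Nat using (ℕ; zero; suc; _+_; _≤_)
open import Data.Fin using (Fin; zero; suc; splitAt)
open import Data.Bool using (Bool; true; false; T; not; _∧_; _∨_; if_then_else_)
open import Data.Sum using (_⊎_; inj₁; inj₂)
open import Data.Product using (Σ; ∃; _×_; _,_)
open import Data.Maybe using (Maybe; just; nothing)
open import Data.List using (List; []; _∷_)
open import Data.Vec using (tabulate; lookup)
open import Data.Fin.Subset using (Subset; ∣_∣; Nonempty)
open import Relation.Binary.PropositionalEquality using (_≡_)

allFin : (k : ℕ) → (Fin k → Bool) → Bool
allFin zero    f = true
allFin (suc k) f = f zero ∧ allFin k (λ i → f (suc i))

record Graph : Set where
  field
    n          : ℕ
    adj        : Fin n → Fin n → Bool
    adj-sym    : ∀ u v → adj u v ≡ adj v u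
    adj-irrefl : ∀ v → adj v v ≡ false

open Graph public

joinAdj : (m n : ℕ) → (Fin m → Fin m → Bool) → (Fin n → Fin n → Bool) →
          Fin (m + n) → Fin (m + n) → Bool
joinAdj m n a b u v with splitAt m u | splitAt m v
... | inj₁ x | inj₁ y = a x y
... | inj₂ x | inj₂ y = b x y
... | inj₁ _ | inj₂ _ = true
... | inj₂ _ | inj₁ _ = true

commonNbhd : (G : Graph) → Subset (n G) → Subset (n G)
commonNbhd G S = tabulate λ u → allFin (n G) λ v → not (lookup S v) ∨ adj G v u

SmallCNS : (G : Graph) → Subset (n G) → Set
SmallCNS G S = Nonempty S × (∣ commonNbhd G S ∣ ≤ ∣ S ∣)

IsUpsilon : Graph → ℕ → Set
IsUpsilon G a =
  (Σ (Subset (n G)) λ S → SmallCNS G S × (∣ S ∣ ≡ a)) ×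
  (∀ (S : Subset (n G)) → SmallCNS G S → a ≤ ∣ S ∣)

-- Hyperopic Cops and Robber on a graph with vertex set Fin N and
-- adjacency adj (loops implicit: staying put is always allowed).

Config : ℕ → ℕ → Set
Config N k = Fin k → Fin N

-- what the cops observe: nothing if the robber's vertex is adjacent to
-- every cop-occupied vertex (invisible), otherwise the robber's vertex.
observe : {N k : ℕ} → (Fin N → Fin N → Bool) → Config N k → Fin N → Maybe (Fin N)
observe {N} {k} adj C r = if allFin k (λ i → adj (C i) r) then nothing else just r

-- A cop strategy: the cops' configuration as a function of the list of
-- observations made so far (most recent first); pos [] is the initial
-- placement.
record CopStrategy (N : ℕ) (adj : Fin N → Fin N → Bool) (k : ℕ) : Set where
  field
    pos   : List (Maybe (Fin N)) → Config N k
    legal : ∀ o h (i : Fin k) →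
            (pos (o ∷ h) i ≡ pos h i) ⊎ T (adj (pos h i) (pos (o ∷ h) i))

open CopStrategy public

-- A robber play: the robber's position after his t-th move (t = 0 is the
-- initial choice), each move to an adjacent vertex or staying put.
-- (The robber is omniscient and the cops deterministic, so quantifying over
-- all robber plays is the same as over all robber strategies.)
LegalRobber : (N : ℕ) → (Fin N → Fin N → Bool) → (ℕ → Fin N) → Set
LegalRobber N adj r = ∀ t → (r (suc t) ≡ r t) ⊎ T (adj (r t) (r (suc t)))

module _ {N : ℕ} {adj : Fin N → Fin N → Bool} {k : ℕ} (σ : CopStrategy N adj k) (r : ℕ → Fin N) where

  -- observations o_{t-1}, …, o_0 available to the cops before their t-th move
  history : ℕ → List (Maybe (Fin N))
  history zero    = []
  history (suc t) = observe adj (pos σ (history t)) (r t) ∷ history t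

  copsAt : ℕ → Config N k
  copsAt t = pos σ (history t)

  -- capture: some cop on the robber's vertex, either right after the
  -- robber's t-th move or right after the cops' (t+1)-th move.
  Captured : Set
  Captured = ∃ λ t → ∃ λ (i : Fin k) → (copsAt t i ≡ r t) ⊎ (copsAt (suc t) i ≡ r t)

WinningStrategy : {N : ℕ} {adj : Fin N → Fin N → Bool} {k : ℕ} → CopStrategy N adj k → Set
WinningStrategy {N} {adj} σ = ∀ (r : ℕ → Fin N) → LegalRobber N adj r → Captured σ r

CopWin : (N : ℕ) → (Fin N → Fin N → Bool) → ℕ → Set
CopWin N adj k = Σ (CopStrategy N adj k) WinningStrategy

HyperopicCopNumber≤ : (N : ℕ) → (Fin N → Fin N → Bool) → ℕ → Set
HyperopicCopNumber≤ N adj m = ∃ λ k → k ≤ m × CopWin N adj k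

-- Place the cops on small common neighbourhood sets S of G and S′ of J of
-- sizes Υ(G) and Υ(J).  A visible robber is adjacent to every cop on the other
-- side of the join and is caught at once.  An invisible robber is adjacent to
-- every cop, so he lies in the common neighbourhood of S (in G) or of S′ (in J);
-- that set has at most |S| (resp. |S′|) vertices, each adjacent to every cop of
-- its side, so with one move those cops occupy all of it.
module Submission where

open import Defs
open import Data.Nat using (ℕ; zero; suc; _+_; _≤_; z≤n; s≤s)
open import Data.Nat.Properties using (≤-reflexive)
open import Data.Fin using (Fin; zero; suc; splitAt; join; _↑ˡ_; _↑ʳ_)
open import Data.Fin.Properties using (splitAt-↑ˡ; splitAt-↑ʳ; join-splitAt)
open import Data.Fin.Subset using (Subset; ∣_∣; _∈_)
open import Data.Bool using (Bool; true; false; T; not; _∨_; if_then_else_)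
open import Data.Bool.Properties using (T-≡; T-∧)
open import Data.Sum using (_⊎_; inj₁; inj₂; [_,_])
import Data.Sum as Sum
open import Data.Product using (∃; _,_; proj₁; proj₂)
import Data.Product as Product
open import Data.Maybe using (Maybe; just; nothing; maybe′)
import Data.Maybe as Maybe
open import Data.List using (List; []; _∷_)
open import Data.Vec using (_∷_; tabulate; lookup; here; there)
open import Data.Vec.Properties using (lookup∘tabulate; lookup⇒[]=; []=⇒lookup)
open import Function using (_∘_)
open import Function.Bundles using (Equivalence)
open import Relation.Binary.PropositionalEquality
  using (_≡_; refl; sym; trans; cong; cong₂; subst; subst₂)

open Equivalence using (to; from)

private
  variable
    k M N s t : ℕ

enumerate : (p : Subset N) → Fin ∣ p ∣ → Fin N
enumerate (true ∷ p) zero    = zero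
enumerate (true ∷ p) (suc i) = suc (enumerate p i)
enumerate (false ∷ p) i      = suc (enumerate p i)

enumerate-∈ : (p : Subset N) (i : Fin ∣ p ∣) → enumerate p i ∈ p
enumerate-∈ (true ∷ p) zero    = here
enumerate-∈ (true ∷ p) (suc i) = there (enumerate-∈ p i)
enumerate-∈ (false ∷ p) i      = there (enumerate-∈ p i)

enumerate-surjective : (p : Subset N) {x : Fin N} → x ∈ p → ∃ λ i → enumerate p i ≡ x
enumerate-surjective (true ∷ p) here          = zero , refl
enumerate-surjective (true ∷ p) (there x∈p)  = Product.map suc (cong suc) (enumerate-surjective p x∈p)
enumerate-surjective (false ∷ p) (there x∈p) = Product.map₂ (cong suc) (enumerate-surjective p x∈p)

lowerMaybe : M ≤ N → Fin N → Maybe (Fin M)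
lowerMaybe z≤n      _       = nothing
lowerMaybe (s≤s le) zero    = just zero
lowerMaybe (s≤s le) (suc i) = Maybe.map suc (lowerMaybe le i)

lowerMaybe-surjective : (le : M ≤ N) (j : Fin M) → ∃ λ i → lowerMaybe le i ≡ just j
lowerMaybe-surjective (s≤s le) zero    = zero , refl
lowerMaybe-surjective (s≤s le) (suc j) =
  Product.map suc (cong (Maybe.map suc)) (lowerMaybe-surjective le j)

allFin⁺ : (f : Fin k → Bool) → (∀ i → T (f i)) → T (allFin k f)
allFin⁺ {k = zero}  f h = _
allFin⁺ {k = suc k} f h = from T-∧ (h zero , allFin⁺ (f ∘ suc) (h ∘ suc))

allFin⁻ : (f : Fin k → Bool) → T (allFin k f) → ∀ i → T (f i)
allFin⁻ {k = suc k} f h zero    = proj₁ (to T-∧ h)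
allFin⁻ {k = suc k} f h (suc i) = allFin⁻ (f ∘ suc) (proj₂ (to T-∧ h)) i

∈-tabulate⁺ : (f : Fin N → Bool) {x : Fin N} → T (f x) → x ∈ tabulate f
∈-tabulate⁺ f {x} fx = lookup⇒[]= x (tabulate f) (trans (lookup∘tabulate f x) (to T-≡ fx))

∈-tabulate⁻ : (f : Fin N → Bool) {x : Fin N} → x ∈ tabulate f → T (f x)
∈-tabulate⁻ f {x} x∈ = from T-≡ (trans (sym (lookup∘tabulate f x)) ([]=⇒lookup x∈))

module _ (G : Graph) (S : Subset (n G)) where

  ∈-commonNbhd⁺ : {u : Fin (n G)} → (∀ {v} → v ∈ S → T (adj G v u)) → u ∈ commonNbhd G S
  ∈-commonNbhd⁺ {u} h = ∈-tabulate⁺ _ (allFin⁺ _ member⇒adjacent)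
    where
    member⇒adjacent : ∀ v → T (not (lookup S v) ∨ adj G v u)
    member⇒adjacent v with lookup S v in e
    ... | true  = h (lookup⇒[]= v S e)
    ... | false = _

  ∈-commonNbhd⁻ : {u v : Fin (n G)} → u ∈ commonNbhd G S → v ∈ S → T (adj G v u)
  ∈-commonNbhd⁻ {u} {v} u∈ v∈S =
    subst (λ b → T (not b ∨ adj G v u)) ([]=⇒lookup v∈S)
      (allFin⁻ _ (∈-tabulate⁻ _ u∈) v)

Step : (Fin N → Fin N → Bool) → Fin N → Fin N → Set
Step adj u v = (v ≡ u) ⊎ T (adj u v)

record Sweep (adj : Fin N → Fin N → Bool) (k : ℕ) : Set where
  field
    home         : Config N k
    sweep        : Config N k
    home⇝sweep   : ∀ i → Step adj (home i) (sweep i)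
    sweep-covers : ∀ v → (∀ i → T (adj (home i) v)) → ∃ λ i → sweep i ≡ v

module OneRound {adj : Fin N → Fin N → Bool} (σ : Sweep adj k) where
  open Sweep σ

  respond : Maybe (Fin N) → Config N k
  respond nothing  = sweep
  respond (just v) i = if adj (home i) v then v else home i

  respond-legal : ∀ o i → Step adj (home i) (respond o i)
  respond-legal nothing  i = home⇝sweep i
  respond-legal (just v) i with adj (home i) v in e
  ... | true  = inj₂ (from T-≡ e)
  ... | false = inj₁ refl

  respond-adjacent : ∀ {i v} → T (adj (home i) v) → respond (just v) i ≡ v
  respond-adjacent adjacent rewrite to T-≡ adjacent = refl

  strategy : CopStrategy N adj k
  strategy = record { pos = position ; legal = position-legal }
    where
    position : List (Maybe (Fin N)) → Config N k
    position []          = home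
    position (o ∷ [])    = respond o
    position (_ ∷ o ∷ h) = position (o ∷ h)

    position-legal : ∀ o h i → Step adj (position h i) (position (o ∷ h) i)
    position-legal o []      i = respond-legal o i
    position-legal _ (_ ∷ _) i = inj₁ refl

  respond-captures : (∀ v → ∃ λ i → T (adj (home i) v)) →
                     ∀ v → ∃ λ i → respond (observe adj home v) i ≡ v
  respond-captures dominating v = by-visibility _ refl
    where
    by-visibility : ∀ b → allFin k (λ i → adj (home i) v) ≡ b →
                    ∃ λ i → respond (if b then nothing else just v) i ≡ v
    by-visibility true  invisible = sweep-covers v (allFin⁻ _ (from T-≡ invisible))
    by-visibility false _ = Product.map₂ respond-adjacent (dominating v)

  strategy-wins : (∀ v → ∃ λ i → T (adj (home i) v)) → WinningStrategy strategy
  strategy-wins dominating r _ =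
    let i , caught = respond-captures dominating (r 0) in 0 , i , inj₂ caught

↑-cases : (P : Fin (M + N) → Set) → (∀ x → P (x ↑ˡ N)) → (∀ y → P (M ↑ʳ y)) → ∀ v → P v
↑-cases {M} {N} P left right v =
  subst P (join-splitAt M N v) ([_,_] {C = P ∘ join M N} left right (splitAt M v))

joinConfig : Config M s → Config N t → Config (M + N) (s + t)
joinConfig {M} {s} {N} f g = join M N ∘ Sum.map f g ∘ splitAt s

module _ {M N s t : ℕ} (f : Config M s) (g : Config N t) where

  joinConfig-↑ˡ : ∀ i → joinConfig f g (i ↑ˡ t) ≡ f i ↑ˡ N
  joinConfig-↑ˡ i = cong (join M N ∘ Sum.map f g) (splitAt-↑ˡ s i t)

  joinConfig-↑ʳ : ∀ i → joinConfig f g (s ↑ʳ i) ≡ M ↑ʳ g i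
  joinConfig-↑ʳ i = cong (join M N ∘ Sum.map f g) (splitAt-↑ʳ s t i)

module _ {M N : ℕ} (a : Fin M → Fin M → Bool) (b : Fin N → Fin N → Bool) where

  joinAdj-↑ˡ : ∀ x y → joinAdj M N a b (x ↑ˡ N) (y ↑ˡ N) ≡ a x y
  joinAdj-↑ˡ x y rewrite splitAt-↑ˡ M x N | splitAt-↑ˡ M y N = refl

  joinAdj-↑ʳ : ∀ x y → joinAdj M N a b (M ↑ʳ x) (M ↑ʳ y) ≡ b x y
  joinAdj-↑ʳ x y rewrite splitAt-↑ʳ M N x | splitAt-↑ʳ M N y = refl

  joinAdj-↑ˡ↑ʳ : ∀ x y → T (joinAdj M N a b (x ↑ˡ N) (M ↑ʳ y))
  joinAdj-↑ˡ↑ʳ x y rewrite splitAt-↑ˡ M x N | splitAt-↑ʳ M N y = _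

  joinAdj-↑ʳ↑ˡ : ∀ x y → T (joinAdj M N a b (M ↑ʳ y) (x ↑ˡ N))
  joinAdj-↑ʳ↑ˡ x y rewrite splitAt-↑ˡ M x N | splitAt-↑ʳ M N y = _

  Step-↑ˡ : ∀ {x y} → Step a x y → Step (joinAdj M N a b) (x ↑ˡ N) (y ↑ˡ N)
  Step-↑ˡ {x} {y} = Sum.map (cong (_↑ˡ N)) (subst T (sym (joinAdj-↑ˡ x y)))

  Step-↑ʳ : ∀ {x y} → Step b x y → Step (joinAdj M N a b) (M ↑ʳ x) (M ↑ʳ y)
  Step-↑ʳ {x} {y} = Sum.map (cong (M ↑ʳ_)) (subst T (sym (joinAdj-↑ʳ x y)))

  joinConfig-dominating : {s t : ℕ} (f : Config M s) (g : Config N t) → Fin s → Fin t →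
    ∀ v → ∃ λ i → T (joinAdj M N a b (joinConfig f g i) v)
  joinConfig-dominating {s} {t} f g i j = ↑-cases _
    (λ x → s ↑ʳ j , subst (λ w → T (joinAdj M N a b w (x ↑ˡ N)))
                          (sym (joinConfig-↑ʳ f g j)) (joinAdj-↑ʳ↑ˡ x (g j)))
    (λ y → i ↑ˡ t , subst (λ w → T (joinAdj M N a b w (M ↑ʳ y)))
                          (sym (joinConfig-↑ˡ f g i)) (joinAdj-↑ˡ↑ʳ (f i) y))

  joinSweep : {s t : ℕ} → Sweep a s → Sweep b t → Sweep (joinAdj M N a b) (s + t)
  joinSweep {s} {t} σ τ = record
    { home         = joinConfig (home σ) (home τ)
    ; sweep        = joinConfig (sweep σ) (sweep τ)
    ; home⇝sweep   = ↑-cases _ left-legal right-legal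
    ; sweep-covers = ↑-cases _ left-covered right-covered
    }
    where
    open Sweep
    A : Fin (M + N) → Fin (M + N) → Bool
    A = joinAdj M N a b

    homes sweeps : Config (M + N) (s + t)
    homes  = joinConfig (home σ) (home τ)
    sweeps = joinConfig (sweep σ) (sweep τ)

    left-legal : ∀ i → Step A (homes (i ↑ˡ t)) (sweeps (i ↑ˡ t))
    left-legal i = subst₂ (Step A) (sym (joinConfig-↑ˡ (home σ) (home τ) i))
                                   (sym (joinConfig-↑ˡ (sweep σ) (sweep τ) i))
                     (Step-↑ˡ (home⇝sweep σ i))

    right-legal : ∀ i → Step A (homes (s ↑ʳ i)) (sweeps (s ↑ʳ i))
    right-legal i = subst₂ (Step A) (sym (joinConfig-↑ʳ (home σ) (home τ) i))
                                    (sym (joinConfig-↑ʳ (sweep σ) (sweep τ) i))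
                      (Step-↑ʳ (home⇝sweep τ i))

    left-covered : ∀ x → (∀ i → T (A (homes i) (x ↑ˡ N))) → ∃ λ i → sweeps i ≡ x ↑ˡ N
    left-covered x adjacent =
      let i , swept = sweep-covers σ x λ i →
            subst T (trans (cong (λ w → A w (x ↑ˡ N)) (joinConfig-↑ˡ (home σ) (home τ) i))
                           (joinAdj-↑ˡ _ x))
                    (adjacent (i ↑ˡ t))
      in i ↑ˡ t , trans (joinConfig-↑ˡ (sweep σ) (sweep τ) i) (cong (_↑ˡ N) swept)

    right-covered : ∀ y → (∀ i → T (A (homes i) (M ↑ʳ y))) → ∃ λ i → sweeps i ≡ M ↑ʳ y
    right-covered y adjacent =
      let i , swept = sweep-covers τ y λ i →
            subst T (trans (cong (λ w → A w (M ↑ʳ y)) (joinConfig-↑ʳ (home σ) (home τ) i))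
                           (joinAdj-↑ʳ _ y))
                    (adjacent (s ↑ʳ i))
      in s ↑ʳ i , trans (joinConfig-↑ʳ (sweep σ) (sweep τ) i) (cong (M ↑ʳ_) swept)

smallCNS-sweep : (G : Graph) (S : Subset (n G)) → ∣ commonNbhd G S ∣ ≤ ∣ S ∣ → Sweep (adj G) ∣ S ∣
smallCNS-sweep G S small = record
  { home         = enumerate S
  ; sweep        = target
  ; home⇝sweep   = legal-move
  ; sweep-covers = covered
  }
  where
  C : Subset (n G)
  C = commonNbhd G S

  target : Fin ∣ S ∣ → Fin (n G)
  target i = maybe′ (enumerate C) (enumerate S i) (lowerMaybe small i)

  legal-move : ∀ i → Step (adj G) (enumerate S i) (target i)
  legal-move i with lowerMaybe small i
  ... | nothing = inj₁ refl
  ... | just j  = inj₂ (∈-commonNbhd⁻ G S (enumerate-∈ C j) (enumerate-∈ S i))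

  covered : ∀ x → (∀ i → T (adj G (enumerate S i) x)) → ∃ λ i → target i ≡ x
  covered x adjacent =
    let x∈C = ∈-commonNbhd⁺ G S λ v∈S →
                let i , eq = enumerate-surjective S v∈S
                in subst (λ w → T (adj G w x)) eq (adjacent i)
        j , enumerated = enumerate-surjective C x∈C
        i , lowered = lowerMaybe-surjective small j
    in i , trans (cong (maybe′ (enumerate C) (enumerate S i)) lowered) enumerated

theorem4p2 : (G J : Graph) (a b : ℕ) → IsUpsilon G a → IsUpsilon J b →
    HyperopicCopNumber≤ (n G + n J) (joinAdj (n G) (n J) (adj G) (adj J)) (a + b)
theorem4p2 G J a b ((S , ((_ , x∈S) , S-small) , ∣S∣≡a) , _)
                   ((S′ , ((_ , x∈S′) , S′-small) , ∣S′∣≡b) , _) =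
  ∣ S ∣ + ∣ S′ ∣ , ≤-reflexive (cong₂ _+_ ∣S∣≡a ∣S′∣≡b) , strategy ,
  strategy-wins (joinConfig-dominating (adj G) (adj J) (enumerate S) (enumerate S′)
                   (proj₁ (enumerate-surjective S x∈S)) (proj₁ (enumerate-surjective S′ x∈S′)))
  where
  open OneRound (joinSweep (adj G) (adj J) (smallCNS-sweep G S S-small)
                                           (smallCNS-sweep J S′ S′-small))
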